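{- Let $G$ be a plane graph in which every $3$-face is adjacent to at most one $3$-face, and suppose $\delta(G)\geq 4$. Then $G$ contains at least one of the following: (H1) an edge both of whose endpoints have degree $4$; (H2) a triangle with one vertex of degree $4$ and the other two vertices of degree $5$; (H3) a triangle whose three vertices have degrees $4$, $5$ and $6$, such that the vertex of degree $6$ has a neighbor of degree $4$ that is not a vertex of the triangle. (All degrees are degrees in $G$.)
   Context: All graphs are finite and simple; $\delta(G)$ is the minimum degree; a triangle is a $3$-cycle. In a plane graph, a $k$-face is a face of length $k$ (length = number of edges on its boundary walk, a cut edge counted twice); two faces are adjacent if they share an edge. -}

module Defs where

open import Data.Nat using (ℕ; zero; suc; _+_; _*_; _<_; _≤_)
open import Data.Fin using (Fin; _≟_)
open import Data.Bool using (Bool; true; false)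
open import Data.List using (List; length; filter; allFin)
open import Data.Product using (Σ; ∃; _×_; _,_)
open import Data.Sum using (_⊎_)
open import Relation.Binary.PropositionalEquality using (_≡_; _≢_)
open import Relation.Binary.Construct.Closure.ReflexiveTransitive using (Star)

iter : ∀ {A : Set} → (A → A) → ℕ → A → A
iter f zero    x = x
iter f (suc k) x = f (iter f k x)

SameOrbit : ∀ {m} → (Fin m → Fin m) → Fin m → Fin m → Set
SameOrbit f d d' = ∃ λ k → iter f k d ≡ d'

-- The subset P of Fin m meets exactly k classes of the relation R
-- (R an equivalence relation): k pairwise inequivalent representatives
-- in P, and every element of P is equivalent to one of them.
NumClasses : ∀ {m} → (Fin m → Fin m → Set) → (Fin m → Set) → ℕ → Set
NumClasses {m} R P k =
  Σ (Fin k → Fin m) λ rep →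
    (∀ i → P (rep i)) ×
    (∀ i j → R (rep i) (rep j) → i ≡ j) ×
    (∀ d → P d → ∃ λ i → R d (rep i))

countEq : ∀ {m k} → (Fin m → Fin k) → Fin k → ℕ
countEq {m} f a = length (filter (λ d → f d ≟ a) (allFin m))

-- Each edge is two darts (half-edges) d, rev d; tail d is the vertex at
-- which d starts; σ is the rotation (cyclic order of darts around each
-- vertex); φ = σ ∘ rev is the face-traversal permutation, whose orbits are
-- the facial boundary walks of the individual connected components.
-- Every connected component is embedded in the sphere (Euler's formula
-- V - E + F = 2 for each component).  To describe an embedding of a
-- possibly disconnected graph in the plane we additionally record, for
-- every component, which of its boundary walks is its outer one, and the
-- faces (regions) of the whole plane graph: region d is the face of G
-- whose boundary contains the walk through dart d.
record PlaneGraph (n : ℕ) : Set₁ where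
  field
    m     : ℕ                      -- number of darts (= 2 * number of edges)
    tail  : Fin m → Fin n
    rev   : Fin m → Fin m
    σ     : Fin m → Fin m
    σ⁻¹   : Fin m → Fin m
    rev-invol : ∀ d → rev (rev d) ≡ d
    no-loop   : ∀ d → tail (rev d) ≢ tail d
    no-multi  : ∀ d d' → tail d ≡ tail d' → tail (rev d) ≡ tail (rev d') → d ≡ d'
    σ-inv₁    : ∀ d → σ (σ⁻¹ d) ≡ d
    σ-inv₂    : ∀ d → σ⁻¹ (σ d) ≡ d
    σ-tail    : ∀ d → tail (σ d) ≡ tail d
    σ-trans   : ∀ d d' → tail d ≡ tail d' → SameOrbit σ d d'

  φ : Fin m → Fin m
  φ d = σ (rev d)

  Step : Fin m → Fin m → Set
  Step d d' = (d' ≡ σ d) ⊎ (d' ≡ rev d)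

  Conn : Fin m → Fin m → Set
  Conn = Star Step

  field
    -- every component is embedded in the sphere: V - E + F = 2,
    -- i.e. 2V + 2F = (number of darts) + 4
    euler : ∀ d₀ V F D →
      NumClasses (SameOrbit σ) (Conn d₀) V →
      NumClasses (SameOrbit φ) (Conn d₀) F →
      NumClasses _≡_ (Conn d₀) D →
      2 * V + 2 * F ≡ D + 4
    outer       : Fin m → Bool
    outer-φ     : ∀ d → outer (φ d) ≡ outer d
    outer-exists : ∀ d → ∃ λ d' → Conn d d' × outer d' ≡ true
    outer-unique : ∀ d d' → Conn d d' → outer d ≡ true → outer d' ≡ true →
                   SameOrbit φ d d'
    k       : ℕ
    region  : Fin m → Fin k
    region-φ : ∀ d → region (φ d) ≡ region d
    region-inner : ∀ d d' → outer d ≡ false → outer d' ≡ false →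
                   region d ≡ region d' → SameOrbit φ d d'
    -- exactly one face (the unbounded one) has only outer boundary walks
    region-unbounded : ∀ d d' →
      (∀ e → region e ≡ region d → outer e ≡ true) →
      (∀ e → region e ≡ region d' → outer e ≡ true) →
      region d ≡ region d'
    -- the nesting of components is acyclic: a component lying in a face
    -- bounded by an inner walk of another component has larger depth
    depth      : Fin m → ℕ
    depth-conn : ∀ d d' → Conn d d' → depth d ≡ depth d'
    depth-nest : ∀ d d' → outer d ≡ true → outer d' ≡ false →
                 region d ≡ region d' → depth d' < depth d

module _ {n : ℕ} (G : PlaneGraph n) where
  open PlaneGraph G

  deg : Fin n → ℕ
  deg v = countEq tail v

  Adj : Fin n → Fin n → Set
  Adj u v = ∃ λ d → tail d ≡ u × tail (rev d) ≡ v

  MinDegAtLeast : ℕ → Set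
  MinDegAtLeast δ = ∀ v → δ ≤ deg v

  faceLength : Fin k → ℕ
  faceLength r = countEq region r

  Is3Face : Fin k → Set
  Is3Face r = faceLength r ≡ 3

  FacesAdj : Fin k → Fin k → Set
  FacesAdj r r' = r ≢ r' × ∃ λ d → region d ≡ r × region (rev d) ≡ r'

  Every3FaceAdjAtMostOne3Face : Set
  Every3FaceAdjAtMostOne3Face = ∀ r r₁ r₂ → Is3Face r → Is3Face r₁ → Is3Face r₂ →
    FacesAdj r r₁ → FacesAdj r r₂ → r₁ ≡ r₂

  Triangle : Fin n → Fin n → Fin n → Set
  Triangle x y z = Adj x y × Adj y z × Adj x z

  H1 : Set
  H1 = ∃ λ u → ∃ λ v → Adj u v × deg u ≡ 4 × deg v ≡ 4

  H2 : Set
  H2 = ∃ λ x → ∃ λ y → ∃ λ z → Triangle x y z × deg x ≡ 4 × deg y ≡ 5 × deg z ≡ 5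

  H3 : Set
  H3 = ∃ λ x → ∃ λ y → ∃ λ z → Triangle x y z × deg x ≡ 4 × deg y ≡ 5 × deg z ≡ 6 ×
       (∃ λ w → Adj z w × deg w ≡ 4 × w ≢ x × w ≢ y × w ≢ z)

{-# OPTIONS --safe #-}
module Submission where

open import Defs
open import Data.Bool using (false; true)
open import Data.Bool.Properties using () renaming (_≟_ to _≟ᵇ_)
open import Data.Nat
  using (ℕ; zero; suc; _+_; _*_; _∸_; _≤_; _<_; z≤n; s≤s; s≤s⁻¹; _≤?_; NonZero; >-nonZero)
open import Data.Nat.Properties hiding (_≟_; suc-injective)
open import Data.Nat.Properties using () renaming (_≟_ to _≟ℕ_)
open import Data.Nat.DivMod using (_%_; _/_; m≡m%n+[m/n]*n; m%n<n)
open import Data.Nat.Tactic.RingSolver using (solve-∀)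
open import Data.Fin using (Fin; zero; suc; _≟_; toℕ; fromℕ<)
open import Data.Fin.Properties
  using (suc-injective; toℕ-injective; toℕ<n; toℕ-fromℕ<; pigeonhole; any?)
open import Data.Fin.Permutation using (permutation)
open import Data.List using (List; []; _∷_; length; filter; tabulate; allFin)
open import Data.List.Membership.Propositional using (_∈_)
open import Data.List.Membership.Propositional.Properties using (∈-allFin)
open import Data.List.Relation.Unary.Any using (here; there)
open import Data.List.Relation.Unary.All using (lookup)
open import Data.List.Extrema ≤-totalOrder using (argmax; f[xs]≤f[argmax])
open import Data.Product using (Σ; ∃; _×_; _,_; proj₁; proj₂)
open import Data.Sum using (_⊎_; inj₁; inj₂)
open import Data.Empty using (⊥; ⊥-elim)
open import Function using (_∘_; id; case_of_)
open import Function.Definitions using (Injective)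
open import Relation.Nullary using (Dec; yes; no; ¬_)
open import Relation.Nullary.Decidable using (_×-dec_; ¬?; ¬¬-excluded-middle)
open import Relation.Binary using (tri<; tri≈; tri>)
open import Relation.Binary.PropositionalEquality
open import Relation.Binary.Construct.Closure.ReflexiveTransitive using (ε; _◅_; _◅◅_)
open import Algebra.Properties.Semiring.Sum +-*-semiring
  using ( sum; sum-syntax; sum-cong-≗; sum-replicate-zero; sum-permute
        ; ∑-comm; ∑-distrib-+; *-distribˡ-sum; *-distribʳ-sum )

-- Suppose that none of H1, H2, H3 occurs, and discharge on a connected component C of maximal nesting
-- depth: no other component lies inside an inner facial walk of C, so its inner triangular walks are
-- genuine 3-faces of G.  With charges scaled by 6, every vertex of C starts with 6·deg − 24 and every
-- facial walk of length ℓ with 6ℓ − 24, so by Euler's formula the total is −48.  Vertices of degree 5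
-- send 2 to each incident 3-face; vertices of degree at least 6 send 4 to a (6,4,5)-triangle, 3 to a
-- triangle with one other vertex of degree 4, and 2 otherwise.  As a 3-face is adjacent to at most one
-- 3-face, at most two of any three consecutive corners at a vertex are triangular; together with ¬H3,
-- which makes the degree-4 neighbour of a 6-vertex on a (6,4,5)-triangle unique, this leaves every
-- vertex with a nonnegative charge.  ¬H1 and ¬H2 make every 3-face receive at least 6, so only the outer
-- walk of C can stay negative, and by at most 6: the total is at least −6, a contradiction.

-- Iverson brackets and finite sums

⟦_⟧ : ∀ {A : Set} → Dec A → ℕ
⟦ yes _ ⟧ = 1
⟦ no  _ ⟧ = 0

⟦⟧≤1 : ∀ {A : Set} (a? : Dec A) → ⟦ a? ⟧ ≤ 1
⟦⟧≤1 (yes _) = s≤s z≤n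
⟦⟧≤1 (no _)  = z≤n

⟦⟧≡1 : ∀ {A : Set} (a? : Dec A) → A → ⟦ a? ⟧ ≡ 1
⟦⟧≡1 (yes _) _ = refl
⟦⟧≡1 (no ¬a) a = ⊥-elim (¬a a)

⟦⟧≡0 : ∀ {A : Set} (a? : Dec A) → ¬ A → ⟦ a? ⟧ ≡ 0
⟦⟧≡0 (yes a) ¬a = ⊥-elim (¬a a)
⟦⟧≡0 (no _)  _  = refl

⟦⟧-cong : ∀ {A B : Set} (a? : Dec A) (b? : Dec B) → (A → B) → (B → A) → ⟦ a? ⟧ ≡ ⟦ b? ⟧
⟦⟧-cong (yes _) (yes _) _   _   = refl
⟦⟧-cong (yes a) (no ¬b) A→B _   = ⊥-elim (¬b (A→B a))
⟦⟧-cong (no ¬a) (yes b) _   B→A = ⊥-elim (¬a (B→A b))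
⟦⟧-cong (no _)  (no _)  _   _   = refl

sum-mono : ∀ {m} {f g : Fin m → ℕ} → (∀ i → f i ≤ g i) → sum f ≤ sum g
sum-mono {zero}  _   = z≤n
sum-mono {suc m} f≤g = +-mono-≤ (f≤g zero) (sum-mono (f≤g ∘ suc))

sum-const : ∀ m c → ∑[ i < m ] c ≡ m * c
sum-const zero    c = refl
sum-const (suc m) c = cong (c +_) (sum-const m c)

term≤sum : ∀ {m} (f : Fin m → ℕ) i → f i ≤ sum f
term≤sum f zero    = m≤m+n _ _
term≤sum f (suc i) = ≤-trans (term≤sum (f ∘ suc) i) (m≤n+m _ (f zero))

sum-point : ∀ {m} (x : Fin m) (w : Fin m → ℕ) → ∑[ d < m ] (⟦ d ≟ x ⟧ * w d) ≡ w x
sum-point {suc m} zero    w =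
  trans (cong (w zero + 0 +_) (sum-replicate-zero m)) (trans (+-identityʳ _) (+-identityʳ _))
sum-point {suc m} (suc x) w =
  trans (sum-cong-≗ (λ d → cong (_* w (suc d)) (⟦⟧-cong (suc d ≟ suc x) (d ≟ x) suc-injective (cong suc))))
        (sum-point x (w ∘ suc))

count≤1 : ∀ {k} {P : Fin k → Set} (P? : ∀ i → Dec (P i)) →
  (∀ {i j} → P i → P j → i ≡ j) → ∑[ i < k ] ⟦ P? i ⟧ ≤ 1
count≤1 {zero}  P? unique = z≤n
count≤1 {suc k} P? unique with P? zero
... | no _  = count≤1 (P? ∘ suc) (λ p q → suc-injective (unique p q))
... | yes p = ≤-reflexive (cong suc (trans (sum-cong-≗ none) (sum-replicate-zero k)))
  where
  none : ∀ i → ⟦ P? (suc i) ⟧ ≡ 0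
  none i = ⟦⟧≡0 (P? (suc i)) (λ q → case unique p q of λ ())

sum-disjoint≤ : ∀ {k m} {P : Fin k → Fin m → Set} (P? : ∀ i d → Dec (P i d)) (w : Fin m → ℕ) →
  (∀ {i j d} → P i d → P j d → i ≡ j) →
  ∑[ i < k ] ∑[ d < m ] (⟦ P? i d ⟧ * w d) ≤ sum w
sum-disjoint≤ {k} {m} P? w disjoint = begin
  ∑[ i < k ] ∑[ d < m ] (⟦ P? i d ⟧ * w d) ≡⟨ ∑-comm (λ i d → ⟦ P? i d ⟧ * w d) ⟩
  ∑[ d < m ] ∑[ i < k ] (⟦ P? i d ⟧ * w d) ≡⟨ sum-cong-≗ (λ d → *-distribʳ-sum (w d) (λ i → ⟦ P? i d ⟧)) ⟨
  ∑[ d < m ] (∑[ i < k ] ⟦ P? i d ⟧ * w d)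
    ≤⟨ sum-mono (λ d → *-monoˡ-≤ (w d) (count≤1 (λ i → P? i d) disjoint)) ⟩
  ∑[ d < m ] (1 * w d)                    ≡⟨ sum-cong-≗ (λ d → *-identityˡ (w d)) ⟩
  sum w                                    ∎
  where open ≤-Reasoning

sum-∘-injective≤ : ∀ {k m} (g : Fin k → Fin m) → Injective _≡_ _≡_ g →
  (w : Fin m → ℕ) → ∑[ j < k ] w (g j) ≤ sum w
sum-∘-injective≤ {k} {m} g g-injective w = begin
  ∑[ j < k ] w (g j)                       ≡⟨ sum-cong-≗ (λ j → sum-point (g j) w) ⟨
  ∑[ j < k ] ∑[ d < m ] (⟦ d ≟ g j ⟧ * w d)
    ≤⟨ sum-disjoint≤ (λ j d → d ≟ g j) w (λ p q → g-injective (trans (sym p) q)) ⟩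
  sum w                                    ∎
  where open ≤-Reasoning

count-covered≤ : ∀ {k m} {P : Fin m → Set} (P? : ∀ d → Dec (P d)) (g : Fin k → Fin m) →
  (∀ d → P d → ∃ λ j → d ≡ g j) → ∑[ d < m ] ⟦ P? d ⟧ ≤ k
count-covered≤ {k} {m} P? g covered = begin
  ∑[ d < m ] ⟦ P? d ⟧                      ≤⟨ sum-mono hit ⟩
  ∑[ d < m ] ∑[ j < k ] ⟦ d ≟ g j ⟧         ≡⟨ ∑-comm (λ d j → ⟦ d ≟ g j ⟧) ⟩
  ∑[ j < k ] ∑[ d < m ] ⟦ d ≟ g j ⟧         ≡⟨ sum-cong-≗ (λ j → trans (sum-cong-≗ {m} (λ d → sym (*-identityʳ _)))
                                                                   (sum-point (g j) (λ _ → 1))) ⟩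
  ∑[ j < k ] 1                             ≡⟨ trans (sum-const k 1) (*-identityʳ k) ⟩
  k                                        ∎
  where
  open ≤-Reasoning
  hit : ∀ d → ⟦ P? d ⟧ ≤ ∑[ j < k ] ⟦ d ≟ g j ⟧
  hit d with P? d
  ... | no _  = z≤n
  ... | yes p with covered d p
  ...   | j , d≡gj = subst (_≤ ∑[ j < k ] ⟦ d ≟ g j ⟧) (⟦⟧≡1 (d ≟ g j) d≡gj) (term≤sum _ j)

countEq≡sum : ∀ {m k} (f : Fin m → Fin k) a → countEq f a ≡ ∑[ d < m ] ⟦ f d ≟ a ⟧
countEq≡sum {m} f a = filter-tabulate id
  where
  filter-tabulate : ∀ {n} (g : Fin n → Fin m) →
    length (filter (λ d → f d ≟ a) (tabulate g)) ≡ ∑[ j < n ] ⟦ f (g j) ≟ a ⟧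
  filter-tabulate {zero}  g = refl
  filter-tabulate {suc n} g with f (g zero) ≟ a
  ... | yes _ = cong suc (filter-tabulate (g ∘ suc))
  ... | no  _ = filter-tabulate (g ∘ suc)

-- Orbits of an injection

module Orbit {m} (f : Fin m → Fin m) (f-injective : Injective _≡_ _≡_ f) where

  iter-+ : ∀ a b x → iter f (a + b) x ≡ iter f a (iter f b x)
  iter-+ zero    b x = refl
  iter-+ (suc a) b x = cong f (iter-+ a b x)

  iter-injective : ∀ k → Injective _≡_ _≡_ (iter f k)
  iter-injective zero    eq = eq
  iter-injective (suc k) eq = iter-injective k (f-injective eq)

  iter-* : ∀ c {p x} → iter f p x ≡ x → iter f (c * p) x ≡ x
  iter-* zero    _ = refl
  iter-* (suc c) {p} {x} eq =
    trans (iter-+ p (c * p) x) (trans (cong (iter f p) (iter-* c eq)) eq)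

  iter-% : ∀ {p x} .{{_ : NonZero p}} → iter f p x ≡ x → ∀ k → iter f k x ≡ iter f (k % p) x
  iter-% {p} {x} eq k = begin
    iter f k x                            ≡⟨ cong (λ i → iter f i x) (m≡m%n+[m/n]*n k p) ⟩
    iter f (k % p + k / p * p) x          ≡⟨ iter-+ (k % p) (k / p * p) x ⟩
    iter f (k % p) (iter f (k / p * p) x) ≡⟨ cong (iter f (k % p)) (iter-* (k / p) eq) ⟩
    iter f (k % p) x                      ∎
    where open ≡-Reasoning

  iter-∸ : ∀ {i j} x → i < j → iter f i x ≡ iter f j x → iter f (j ∸ i) x ≡ x
  iter-∸ {i} {j} x i<j eq = iter-injective i (begin
    iter f i (iter f (j ∸ i) x) ≡⟨ iter-+ i (j ∸ i) x ⟨
    iter f (i + (j ∸ i)) x      ≡⟨ cong (λ k → iter f k x) (m+[n∸m]≡n (<⇒≤ i<j)) ⟩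
    iter f j x                  ≡⟨ eq ⟨
    iter f i x                  ∎)
    where open ≡-Reasoning

  iter-period : ∀ x → ∃ λ p → 0 < p × iter f p x ≡ x
  iter-period x with pigeonhole (n<1+n m) (λ (i : Fin (suc m)) → iter f (toℕ i) x)
  ... | i , j , i<j , eq = toℕ j ∸ toℕ i , m<n⇒0<n∸m i<j , iter-∸ x i<j eq

  sameOrbit-refl : ∀ x → SameOrbit f x x
  sameOrbit-refl x = 0 , refl

  sameOrbit-trans : ∀ {x y z} → SameOrbit f x y → SameOrbit f y z → SameOrbit f x z
  sameOrbit-trans {x} (k , refl) (l , refl) = l + k , iter-+ l k x

  sameOrbit-sym : ∀ {x y} → SameOrbit f x y → SameOrbit f y x
  sameOrbit-sym {x} (k , refl) with iter-period x
  ... | p , 0<p , eq = k * p ∸ k , (begin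
    iter f (k * p ∸ k) (iter f k x) ≡⟨ iter-+ (k * p ∸ k) k x ⟨
    iter f (k * p ∸ k + k) x        ≡⟨ cong (λ i → iter f i x) (m∸n+n≡m (m≤m*n k p {{>-nonZero 0<p}})) ⟩
    iter f (k * p) x                ≡⟨ iter-* k eq ⟩
    x                               ∎)
    where open ≡-Reasoning

  sameOrbit⇒iter< : ∀ {p x y} .{{_ : NonZero p}} → iter f p x ≡ x →
    SameOrbit f x y → ∃ λ (j : Fin p) → y ≡ iter f (toℕ j) x
  sameOrbit⇒iter< {p} {x} eq (k , refl) =
    fromℕ< (m%n<n k p) , trans (iter-% eq k) (cong (λ i → iter f i x) (sym (toℕ-fromℕ< (m%n<n k p))))

  iter-injective-below : ∀ {k x} → (∀ p → 0 < p → p < k → iter f p x ≢ x) →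
    Injective _≡_ _≡_ (λ (j : Fin k) → iter f (toℕ j) x)
  iter-injective-below {x = x} aperiodic {i} {j} eq with <-cmp (toℕ i) (toℕ j)
  ... | tri< i<j _ _ = ⊥-elim (aperiodic _ (m<n⇒0<n∸m i<j)
                         (≤-<-trans (m∸n≤m _ (toℕ i)) (toℕ<n j)) (iter-∸ x i<j eq))
  ... | tri≈ _ i≡j _ = toℕ-injective i≡j
  ... | tri> _ _ j<i = ⊥-elim (aperiodic _ (m<n⇒0<n∸m j<i)
                         (≤-<-trans (m∸n≤m _ (toℕ j)) (toℕ<n i)) (iter-∸ x j<i (sym eq)))

-- Counting equivalence classes

module _ {m} {R : Fin m → Fin m → Set} (R? : ∀ a b → Dec (R a b))
         (R-sym : ∀ {a b} → R a b → R b a) where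

  numClasses-exists : ∀ {P : Fin m → Set} → (∀ d → Dec (P d)) → (∀ a → R a a) →
    ∃ λ k → NumClasses R P k
  numClasses-exists {P} P? R-refl =
    let k , rep , P-rep , distinct , cover = collect (allFin m)
    in  k , rep , P-rep , distinct , λ d → cover d (∈-allFin d)
    where
    ClassesAmong : List (Fin m) → Set
    ClassesAmong xs = ∃ λ k → Σ (Fin k → Fin m) λ rep →
      (∀ i → P (rep i)) × (∀ i j → R (rep i) (rep j) → i ≡ j) ×
      (∀ d → d ∈ xs → P d → ∃ λ i → R d (rep i))

    collect : ∀ xs → ClassesAmong xs
    collect [] = 0 , (λ ()) , (λ ()) , (λ ()) , (λ _ ())
    collect (x ∷ xs) with collect xs
    ... | k , rep , P-rep , distinct , cover with P? x | any? (λ i → R? x (rep i))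
    ...   | no ¬Px | _ = k , rep , P-rep , distinct , λ
      { d (here refl) Pd → ⊥-elim (¬Px Pd) ; d (there d∈xs) Pd → cover d d∈xs Pd }
    ...   | yes _ | yes (i , Rxi) = k , rep , P-rep , distinct , λ
      { d (here refl) _ → i , Rxi ; d (there d∈xs) Pd → cover d d∈xs Pd }
    ...   | yes Px | no new = suc k , rep′ , P-rep′ , distinct′ , cover′
      where
      rep′ : Fin (suc k) → Fin m
      rep′ zero    = x
      rep′ (suc i) = rep i
      P-rep′ : ∀ i → P (rep′ i)
      P-rep′ zero    = Px
      P-rep′ (suc i) = P-rep i
      distinct′ : ∀ i j → R (rep′ i) (rep′ j) → i ≡ j
      distinct′ zero    zero    _ = refl
      distinct′ zero    (suc j) r = ⊥-elim (new (j , r))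
      distinct′ (suc i) zero    r = ⊥-elim (new (i , R-sym r))
      distinct′ (suc i) (suc j) r = cong suc (distinct i j r)
      cover′ : ∀ d → d ∈ x ∷ xs → P d → ∃ λ i → R d (rep′ i)
      cover′ d (here refl) _ = zero , R-refl x
      cover′ d (there d∈xs) Pd with cover d d∈xs Pd
      ... | i , r = suc i , r

  classes-weight≥ : (∀ {a b c} → R a b → R b c → R a c) →
    ∀ {k} (rep : Fin k → Fin m) → (∀ i j → R (rep i) (rep j) → i ≡ j) →
    (w : Fin m → ℕ) {c : ℕ} → (∀ i → c ≤ ∑[ d < m ] (⟦ R? d (rep i) ⟧ * w d)) → k * c ≤ sum w
  classes-weight≥ R-trans {k} rep distinct w {c} heavy = begin
    k * c                                          ≡⟨ sum-const k c ⟨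
    ∑[ i < k ] c                                   ≤⟨ sum-mono heavy ⟩
    ∑[ i < k ] ∑[ d < m ] (⟦ R? d (rep i) ⟧ * w d) ≤⟨ sum-disjoint≤ (λ i d → R? d (rep i)) w
                                                        (λ p q → distinct _ _ (R-trans (R-sym p) q)) ⟩
    sum w                                          ∎
    where open ≤-Reasoning

numClasses-≡-count≤ : ∀ {m D} {P : Fin m → Set} (P? : ∀ d → Dec (P d)) →
  NumClasses _≡_ P D → ∑[ d < m ] ⟦ P? d ⟧ ≤ D
numClasses-≡-count≤ P? (rep , _ , _ , cover) = count-covered≤ P? rep cover

¬¬-∀ : ∀ {m} {Q : Fin m → Set} → (∀ x → ¬ ¬ Q x) → ¬ ¬ (∀ x → Q x)
¬¬-∀ {zero}  _  k = k (λ ())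
¬¬-∀ {suc m} ¬¬Q k = ¬¬Q zero λ q₀ → ¬¬-∀ (¬¬Q ∘ suc) λ qₛ → k λ { zero → q₀ ; (suc x) → qₛ x }

¬¬-decidable : ∀ {m} (Q : Fin m → Set) → ¬ ¬ (∀ x → Dec (Q x))
¬¬-decidable Q = ¬¬-∀ (λ x → ¬¬-excluded-middle)

¬¬-decidable₂ : ∀ {m} (Q : Fin m → Fin m → Set) → ¬ ¬ (∀ x y → Dec (Q x y))
¬¬-decidable₂ Q = ¬¬-∀ (λ x → ¬¬-decidable (Q x))

-- Darts, faces and vertices of a plane graph

module Darts {n} (G : PlaneGraph n) where
  open PlaneGraph G public

  σ-injective : Injective _≡_ _≡_ σ
  σ-injective {a} {b} eq = trans (sym (σ-inv₂ a)) (trans (cong σ⁻¹ eq) (σ-inv₂ b))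

  rev-injective : Injective _≡_ _≡_ rev
  rev-injective {a} {b} eq = trans (sym (rev-invol a)) (trans (cong rev eq) (rev-invol b))

  φ-injective : Injective _≡_ _≡_ φ
  φ-injective = rev-injective ∘ σ-injective

  module σ-Orbit = Orbit σ σ-injective
  module φ-Orbit = Orbit φ φ-injective

  tail-φ : ∀ d → tail (φ d) ≡ tail (rev d)
  tail-φ d = σ-tail (rev d)

  tail-φ≢tail : ∀ d → tail (φ d) ≢ tail d
  tail-φ≢tail d eq = no-loop d (trans (sym (tail-φ d)) eq)

  dart-determined : ∀ {d e} → tail d ≡ tail e → tail (φ d) ≡ tail (rev e) → d ≡ e
  dart-determined {d} {e} t h = no-multi d e t (trans (sym (tail-φ d)) h)

  region-iter : ∀ k d → region (iter φ k d) ≡ region d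
  region-iter zero    d = refl
  region-iter (suc k) d = trans (region-φ (iter φ k d)) (region-iter k d)

  region-rev : ∀ d → region (rev d) ≡ region (σ d)
  region-rev d = trans (sym (region-φ (rev d))) (cong (region ∘ σ) (rev-invol d))

  Adj-sym : ∀ {u v} → Adj G u v → Adj G v u
  Adj-sym (d , refl , refl) = rev d , refl , cong tail (rev-invol d)

  deg≡sum : ∀ v → deg G v ≡ ∑[ d < m ] ⟦ tail d ≟ v ⟧
  deg≡sum = countEq≡sum tail

  deg≤period : ∀ {k} d .{{_ : NonZero k}} → iter σ k d ≡ d → deg G (tail d) ≤ k
  deg≤period {k} d period = subst (_≤ k) (sym (deg≡sum (tail d)))
    (count-covered≤ (λ x → tail x ≟ tail d) (λ j → iter σ (toℕ j) d)
      (λ x tx≡td → σ-Orbit.sameOrbit⇒iter< period (σ-trans d x (sym tx≡td))))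

  conn-iter : ∀ {f} → (∀ d → Conn d (f d)) → ∀ k d → Conn d (iter f k d)
  conn-iter step zero    d = ε
  conn-iter step (suc k) d = conn-iter step k d ◅◅ step (iter _ k d)

  conn-sameOrbit : ∀ {f} → (∀ d → Conn d (f d)) → ∀ {d d′} → SameOrbit f d d′ → Conn d d′
  conn-sameOrbit step (k , refl) = conn-iter step k _

  conn-σ : ∀ d → Conn d (σ d)
  conn-σ d = inj₁ refl ◅ ε

  conn-φ : ∀ d → Conn d (φ d)
  conn-φ d = inj₂ refl ◅ conn-σ (rev d)

  conn-sym : ∀ {a b} → Conn a b → Conn b a
  conn-sym ε = ε
  conn-sym (inj₁ refl ◅ path) = conn-sym path ◅◅ conn-sameOrbit conn-σ (σ-Orbit.sameOrbit-sym (1 , refl))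
  conn-sym {a} (inj₂ refl ◅ path) = conn-sym path ◅◅ inj₂ (sym (rev-invol a)) ◅ ε

  triangle-rotate : ∀ {x y z} → Triangle G x y z → Triangle G y z x
  triangle-rotate (x~y , y~z , x~z) = y~z , Adj-sym x~z , Adj-sym x~y

  triangle-reverse : ∀ {x y z} → Triangle G x y z → Triangle G z y x
  triangle-reverse (x~y , y~z , x~z) = Adj-sym y~z , Adj-sym x~y , Adj-sym x~z

  Triangular : Fin m → Set
  Triangular c = iter φ 3 c ≡ c

  triangular-φ : ∀ {c} → Triangular c → Triangular (φ c)
  triangular-φ = cong φ

  triangular⇒Triangle : ∀ {c} → Triangular c → Triangle G (tail c) (tail (φ c)) (tail (φ (φ c)))
  triangular⇒Triangle {c} tri =
    (c , refl , sym (tail-φ c)) ,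
    (φ c , refl , sym (tail-φ (φ c))) ,
    Adj-sym (φ (φ c) , refl , trans (sym (tail-φ (φ (φ c)))) (cong tail tri))

  triangular-tail : ∀ {c x} → Triangular c → SameOrbit φ c x → tail x ≡ tail c → x ≡ c
  triangular-tail {c} tri c~x tx≡tc with φ-Orbit.sameOrbit⇒iter< {3} tri c~x
  ... | zero , x≡c = x≡c
  ... | suc zero , refl = ⊥-elim (tail-φ≢tail c tx≡tc)
  ... | suc (suc zero) , refl = ⊥-elim (tail-φ≢tail (φ (φ c)) (trans (cong tail tri) (sym tx≡tc)))

  triangular≡σ : ∀ {c e} → Triangular c → tail c ≡ tail e → tail (φ (φ c)) ≡ tail (rev e) → c ≡ σ e
  triangular≡σ {c} {e} tri t h = trans (sym tri) (cong σ (no-multi _ e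
    (trans (sym (tail-φ (φ (φ c)))) (trans (cong tail tri) t))
    (trans (cong tail (rev-invol _)) h)))

  vertexSum : Fin n → (Fin m → ℕ) → ℕ
  vertexSum v g = ∑[ d < m ] (⟦ tail d ≟ v ⟧ * g d)

  vertexSum-mono : ∀ v {g h : Fin m → ℕ} → (∀ d → tail d ≡ v → g d ≤ h d) →
    vertexSum v g ≤ vertexSum v h
  vertexSum-mono v {g} {h} g≤h = sum-mono pointwise
    where
    pointwise : ∀ d → ⟦ tail d ≟ v ⟧ * g d ≤ ⟦ tail d ≟ v ⟧ * h d
    pointwise d with tail d ≟ v
    ... | yes td≡v = *-monoʳ-≤ 1 (g≤h d td≡v)
    ... | no  _    = z≤n

  vertexSum-+ : ∀ v (g h : Fin m → ℕ) → vertexSum v (λ d → g d + h d) ≡ vertexSum v g + vertexSum v h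
  vertexSum-+ v g h = trans (sum-cong-≗ (λ d → *-distribˡ-+ ⟦ tail d ≟ v ⟧ (g d) (h d)))
    (∑-distrib-+ (λ d → ⟦ tail d ≟ v ⟧ * g d) (λ d → ⟦ tail d ≟ v ⟧ * h d))

  vertexSum-* : ∀ v k (g : Fin m → ℕ) → vertexSum v (λ d → k * g d) ≡ k * vertexSum v g
  vertexSum-* v k g = trans (sum-cong-≗ (λ d → swap ⟦ tail d ≟ v ⟧ k (g d)))
    (sym (*-distribˡ-sum k (λ d → ⟦ tail d ≟ v ⟧ * g d)))
    where
    swap : ∀ a b c → a * (b * c) ≡ b * (a * c)
    swap = solve-∀

  vertexSum-σ : ∀ v (g : Fin m → ℕ) → vertexSum v (g ∘ σ) ≡ vertexSum v g
  vertexSum-σ v g = begin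
    ∑[ d < m ] (⟦ tail d ≟ v ⟧ * g (σ d))
      ≡⟨ sum-cong-≗ (λ d → cong (λ u → ⟦ u ≟ v ⟧ * g (σ d)) (sym (σ-tail d))) ⟩
    ∑[ d < m ] (⟦ tail (σ d) ≟ v ⟧ * g (σ d)) ≡⟨ sum-permute _ (permutation σ σ⁻¹ σ-inv₁ σ-inv₂) ⟨
    vertexSum v g                             ∎
    where open ≡-Reasoning

  vertexSum-1 : ∀ v → vertexSum v (λ _ → 1) ≡ deg G v
  vertexSum-1 v = trans (sum-cong-≗ {m} (λ d → *-identityʳ _)) (sym (deg≡sum v))

  vertexSum-point≤1 : ∀ v x → vertexSum v (λ d → ⟦ d ≟ x ⟧) ≤ 1
  vertexSum-point≤1 v x = begin
    ∑[ d < m ] (⟦ tail d ≟ v ⟧ * ⟦ d ≟ x ⟧)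
      ≤⟨ sum-mono (λ d → *-monoˡ-≤ ⟦ d ≟ x ⟧ (⟦⟧≤1 (tail d ≟ v))) ⟩
    ∑[ d < m ] (1 * ⟦ d ≟ x ⟧)             ≡⟨ sum-cong-≗ (λ d → *-comm 1 ⟦ d ≟ x ⟧) ⟩
    ∑[ d < m ] (⟦ d ≟ x ⟧ * 1)             ≡⟨ sum-point x (λ _ → 1) ⟩
    1                                      ∎
    where open ≤-Reasoning

-- The discharging rules

data DegClass : Set where
  four five sixPlus : DegClass

degClass : ℕ → DegClass
degClass 5                                      = five
degClass (suc (suc (suc (suc (suc (suc _)))))) = sixPlus
degClass _                                      = four

degClass≡four : ∀ {k} → 4 ≤ k → degClass k ≡ four → k ≡ 4
degClass≡four {4} _ _ = refl
degClass≡four {1} (s≤s ()) _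
degClass≡four {2} (s≤s (s≤s ())) _
degClass≡four {3} (s≤s (s≤s (s≤s ()))) _
degClass≡four {5} _ ()
degClass≡four {suc (suc (suc (suc (suc (suc _)))))} _ ()

degClass≡five : ∀ {k} → degClass k ≡ five → k ≡ 5
degClass≡five {5} _ = refl
degClass≡five {0} ()
degClass≡five {1} ()
degClass≡five {2} ()
degClass≡five {3} ()
degClass≡five {4} ()
degClass≡five {suc (suc (suc (suc (suc (suc _)))))} ()

-- The charge sent by a vertex of class a to a 3-face whose next two vertices along the facial walk have
-- classes b and c.
transfer : DegClass → DegClass → DegClass → ℕ
transfer four    _    _    = 0
transfer five    _    _    = 2
transfer sixPlus four five = 4
transfer sixPlus five four = 4
transfer sixPlus four _    = 3
transfer sixPlus _    four = 3
transfer sixPlus _    _    = 2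

transfer≤4 : ∀ a b c → transfer a b c ≤ 4
transfer≤4 four    _       _       = z≤n
transfer≤4 five    _       _       = s≤s (s≤s z≤n)
transfer≤4 sixPlus four    four    = s≤s (s≤s (s≤s z≤n))
transfer≤4 sixPlus four    five    = ≤-refl
transfer≤4 sixPlus four    sixPlus = s≤s (s≤s (s≤s z≤n))
transfer≤4 sixPlus five    four    = ≤-refl
transfer≤4 sixPlus five    five    = s≤s (s≤s z≤n)
transfer≤4 sixPlus five    sixPlus = s≤s (s≤s z≤n)
transfer≤4 sixPlus sixPlus four    = s≤s (s≤s (s≤s z≤n))
transfer≤4 sixPlus sixPlus five    = s≤s (s≤s z≤n)
transfer≤4 sixPlus sixPlus sixPlus = s≤s (s≤s z≤n)

transfer-sixPlus≡4 : ∀ b c → transfer sixPlus b c ≡ 4 → (b ≡ four × c ≡ five) ⊎ (b ≡ five × c ≡ four)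
transfer-sixPlus≡4 four five _ = inj₁ (refl , refl)
transfer-sixPlus≡4 five four _ = inj₂ (refl , refl)
transfer-sixPlus≡4 four    four    ()
transfer-sixPlus≡4 four    sixPlus ()
transfer-sixPlus≡4 five    five    ()
transfer-sixPlus≡4 five    sixPlus ()
transfer-sixPlus≡4 sixPlus four    ()
transfer-sixPlus≡4 sixPlus five    ()
transfer-sixPlus≡4 sixPlus sixPlus ()

transfer-sixPlus≥3 : ∀ b c → 3 ≤ transfer sixPlus b c → b ≡ four ⊎ c ≡ four
transfer-sixPlus≥3 four    _       _ = inj₁ refl
transfer-sixPlus≥3 five    four    _ = inj₂ refl
transfer-sixPlus≥3 sixPlus four    _ = inj₂ refl
transfer-sixPlus≥3 five    five    (s≤s (s≤s ()))
transfer-sixPlus≥3 five    sixPlus (s≤s (s≤s ()))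
transfer-sixPlus≥3 sixPlus five    (s≤s (s≤s ()))
transfer-sixPlus≥3 sixPlus sixPlus (s≤s (s≤s ()))

Reducible : DegClass → DegClass → DegClass → Set
Reducible a b c = (a ≡ four × b ≡ four) ⊎ (a ≡ four × b ≡ five × c ≡ five)

received≥6 : ∀ a b c → ¬ Reducible a b c → ¬ Reducible b c a → ¬ Reducible c a b →
  6 ≤ transfer a b c + transfer b c a + transfer c a b
received≥6 four    four    _       r _ _ = ⊥-elim (r (inj₁ (refl , refl)))
received≥6 _       four    four    _ r _ = ⊥-elim (r (inj₁ (refl , refl)))
received≥6 four    _       four    _ _ r = ⊥-elim (r (inj₁ (refl , refl)))
received≥6 four    five    five    r _ _ = ⊥-elim (r (inj₂ (refl , refl , refl)))
received≥6 five    four    five    _ r _ = ⊥-elim (r (inj₂ (refl , refl , refl)))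
received≥6 five    five    four    _ _ r = ⊥-elim (r (inj₂ (refl , refl , refl)))
received≥6 four    five    sixPlus _ _ _ = ≤-refl
received≥6 four    sixPlus five    _ _ _ = ≤-refl
received≥6 four    sixPlus sixPlus _ _ _ = ≤-refl
received≥6 five    four    sixPlus _ _ _ = ≤-refl
received≥6 five    five    five    _ _ _ = ≤-refl
received≥6 five    five    sixPlus _ _ _ = ≤-refl
received≥6 five    sixPlus four    _ _ _ = ≤-refl
received≥6 five    sixPlus five    _ _ _ = ≤-refl
received≥6 five    sixPlus sixPlus _ _ _ = ≤-refl
received≥6 sixPlus four    five    _ _ _ = ≤-refl
received≥6 sixPlus four    sixPlus _ _ _ = ≤-refl
received≥6 sixPlus five    four    _ _ _ = ≤-refl
received≥6 sixPlus five    five    _ _ _ = ≤-refl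
received≥6 sixPlus five    sixPlus _ _ _ = ≤-refl
received≥6 sixPlus sixPlus four    _ _ _ = ≤-refl
received≥6 sixPlus sixPlus five    _ _ _ = ≤-refl
received≥6 sixPlus sixPlus sixPlus _ _ _ = ≤-refl

3m≤3n+2⇒m≤n : ∀ {m} n → 3 * m ≤ 3 * n + 2 → m ≤ n
3m≤3n+2⇒m≤n {m} n le = s≤s⁻¹ (*-cancelˡ-< 3 m (suc n) (≤-trans (s≤s le) (≤-reflexive (eq n))))
  where
  eq : ∀ n → suc (3 * n + 2) ≡ 3 * suc n
  eq = solve-∀

high-degree-balance : ∀ k {s c} → s ≤ 4 * c → 3 * c ≤ 2 * (7 + k) → s + 24 ≤ 6 * (7 + k)
high-degree-balance k {s} {c} s≤4c 3c≤2D = 3m≤3n+2⇒m≤n (6 * (7 + k)) (begin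
  3 * (s + 24)           ≡⟨ distrib s ⟩
  3 * s + 72             ≤⟨ +-monoˡ-≤ 72 (*-monoʳ-≤ 3 s≤4c) ⟩
  3 * (4 * c) + 72       ≡⟨ cong (_+ 72) (reorder c) ⟩
  4 * (3 * c) + 72       ≤⟨ +-monoˡ-≤ 72 (*-monoʳ-≤ 4 3c≤2D) ⟩
  4 * (2 * (7 + k)) + 72 ≤⟨ m≤m+n _ (10 * k) ⟩
  4 * (2 * (7 + k)) + 72 + 10 * k ≡⟨ expand k ⟩
  3 * (6 * (7 + k)) + 2  ∎)
  where
  open ≤-Reasoning
  distrib : ∀ x → 3 * (x + 24) ≡ 3 * x + 72
  distrib = solve-∀
  reorder : ∀ x → 3 * (4 * x) ≡ 4 * (3 * x)
  reorder = solve-∀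
  expand : ∀ k → 4 * (2 * (7 + k)) + 72 + 10 * k ≡ 3 * (6 * (7 + k)) + 2
  expand = solve-∀

triangle-share≥24 : ∀ s₁ s₂ s₃ o₁ o₂ o₃ → 6 ≤ s₁ + s₂ + s₃ ⊎ 1 ≤ o₁ + (o₂ + (o₃ + 0)) →
  24 ≤ (6 + s₁ + 6 * o₁) + ((6 + s₂ + 6 * o₂) + ((6 + s₃ + 6 * o₃) + 0))
triangle-share≥24 s₁ s₂ s₃ o₁ o₂ o₃ enough = subst (24 ≤_) (sym (regroup s₁ s₂ s₃ o₁ o₂ o₃)) (bound enough)
  where
  regroup : ∀ s₁ s₂ s₃ o₁ o₂ o₃ → (6 + s₁ + 6 * o₁) + ((6 + s₂ + 6 * o₂) + ((6 + s₃ + 6 * o₃) + 0)) ≡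
                                18 + (s₁ + s₂ + s₃) + 6 * (o₁ + (o₂ + (o₃ + 0)))
  regroup = solve-∀
  bound : 6 ≤ s₁ + s₂ + s₃ ⊎ 1 ≤ o₁ + (o₂ + (o₃ + 0)) → 24 ≤ 18 + (s₁ + s₂ + s₃) + 6 * (o₁ + (o₂ + (o₃ + 0)))
  bound (inj₁ 6≤s) = ≤-trans (+-monoʳ-≤ 18 6≤s) (m≤m+n _ (6 * (o₁ + (o₂ + (o₃ + 0)))))
  bound (inj₂ 1≤o) = +-mono-≤ (m≤m+n 18 (s₁ + s₂ + s₃)) (*-monoʳ-≤ 6 1≤o)

euler-overcharged : ∀ V F D {X Y C} → V * 24 ≤ X → F * 24 ≤ Y → X + Y ≤ 12 * C + 6 → C ≤ D →
  2 * V + 2 * F ≡ D + 4 → ⊥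
euler-overcharged V F D {X} {Y} {C} V≤X F≤Y X+Y≤C C≤D euler′ = <⇒≱ (+-monoʳ-< (12 * D) 6<48) (begin
  12 * D + 48          ≡⟨ scale D ⟩
  12 * (D + 4)         ≡⟨ cong (12 *_) euler′ ⟨
  12 * (2 * V + 2 * F) ≡⟨ split V F ⟩
  V * 24 + F * 24      ≤⟨ +-mono-≤ V≤X F≤Y ⟩
  X + Y                ≤⟨ X+Y≤C ⟩
  12 * C + 6           ≤⟨ +-monoˡ-≤ 6 (*-monoʳ-≤ 12 C≤D) ⟩
  12 * D + 6           ∎)
  where
  open ≤-Reasoning
  6<48 : 6 < 48
  6<48 = ≤-trans (s≤s ≤-refl) (m≤m+n 7 41)
  scale : ∀ D → 12 * D + 48 ≡ 12 * (D + 4)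
  scale = solve-∀
  split : ∀ V F → 12 * (2 * V + 2 * F) ≡ V * 24 + F * 24
  split = solve-∀

-- Discharging on a deepest component

module Discharging {n} (G : PlaneGraph n)
  (adj≤1 : Every3FaceAdjAtMostOne3Face G) (δ≥4 : MinDegAtLeast G 4)
  (¬h1 : ¬ H1 G) (¬h2 : ¬ H2 G) (¬h3 : ¬ H3 G)
  (d₀ : Fin (PlaneGraph.m G)) (depth≤d₀ : ∀ d → PlaneGraph.depth G d ≤ PlaneGraph.depth G d₀) where
  open Darts G

  cls : Fin n → DegClass
  cls v = degClass (deg G v)

  cls≡four⇒deg≡4 : ∀ {v} → cls v ≡ four → deg G v ≡ 4
  cls≡four⇒deg≡4 = degClass≡four (δ≥4 _)

  σ-aperiodic : ∀ k d → k < 3 → iter σ (suc k) d ≢ d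
  σ-aperiodic k d k<3 period = <⇒≱ (s≤s k<3) (≤-trans (δ≥4 (tail d)) (deg≤period d period))

  φ²≢id : ∀ r → φ (φ r) ≢ r
  φ²≢id r φ²r≡r = σ-aperiodic 0 (rev r) (s≤s z≤n)
    (dart-determined (tail-φ r) (trans (cong tail φ²r≡r) (sym (cong tail (rev-invol r)))))

  faceWalk-aperiodic : ∀ r p → 0 < p → p < 3 → iter φ p r ≢ r
  faceWalk-aperiodic r 1 _ _ = tail-φ≢tail r ∘ cong tail
  faceWalk-aperiodic r 2 _ _ = φ²≢id r
  faceWalk-aperiodic r (suc (suc (suc _))) _ (s≤s (s≤s (s≤s ())))

  -- No component lies inside an inner walk of a deepest component, so these corners are exactly the
  -- corners of the 3-faces of G at depth d₀.
  TriCorner : Fin m → Set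
  TriCorner c = Triangular c × outer c ≡ false × depth c ≡ depth d₀

  triCorner? : ∀ c → Dec (TriCorner c)
  triCorner? c = (iter φ 3 c ≟ c) ×-dec (outer c ≟ᵇ false) ×-dec (depth c ≟ℕ depth d₀)

  triCorner-φ : ∀ {c} → TriCorner c → TriCorner (φ c)
  triCorner-φ {c} (tri , inner , deepest) =
    triangular-φ tri , trans (outer-φ c) inner , trans (sym (depth-conn c (φ c) (conn-φ c))) deepest

  triCorner⇒3face : ∀ {c} → TriCorner c → Is3Face G (region c)
  triCorner⇒3face {c} (tri , inner , deepest) =
    trans (countEq≡sum region (region c)) (≤-antisym upper lower)
    where
    walk : Fin 3 → Fin m
    walk j = iter φ (toℕ j) c

    on-walk : ∀ d → region d ≡ region c → ∃ λ j → d ≡ walk j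
    on-walk d rd≡rc with outer d in outer-d
    ... | true  = ⊥-elim (<⇒≱ (depth-nest d c outer-d inner rd≡rc) (subst (depth d ≤_) (sym deepest) (depth≤d₀ d)))
    ... | false = φ-Orbit.sameOrbit⇒iter< tri (region-inner c d inner outer-d (sym rd≡rc))

    upper : ∑[ d < m ] ⟦ region d ≟ region c ⟧ ≤ 3
    upper = count-covered≤ (λ d → region d ≟ region c) walk on-walk

    lower : 3 ≤ ∑[ d < m ] ⟦ region d ≟ region c ⟧
    lower = subst (_≤ ∑[ d < m ] ⟦ region d ≟ region c ⟧)
      (sum-cong-≗ (λ j → ⟦⟧≡1 (region (walk j) ≟ region c) (region-iter (toℕ j) c)))
      (sum-∘-injective≤ walk (φ-Orbit.iter-injective-below (faceWalk-aperiodic c)) (λ d → ⟦ region d ≟ region c ⟧))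

  region-σ≢ : ∀ d → TriCorner d → TriCorner (σ d) → region (σ d) ≢ region d
  region-σ≢ d (tri , inner , _) (_ , inner′ , _) eq =
    σ-aperiodic 0 d (s≤s z≤n) (triangular-tail tri (region-inner d (σ d) inner inner′ (sym eq)) (σ-tail d))

  -- The 3-faces at d and σ (σ d) are both adjacent to the 3-face at σ d, hence equal; then σ (σ d) ≡ d.
  no-three-consecutive : ∀ d → TriCorner d → TriCorner (σ d) → TriCorner (σ (σ d)) → ⊥
  no-three-consecutive d t₀@(tri₀ , inner₀ , _) t₁ t₂@(_ , inner₂ , _) =
    σ-aperiodic 1 d (s≤s (s≤s z≤n))
      (triangular-tail tri₀ (region-inner d (σ (σ d)) inner₀ inner₂ same-face) (trans (σ-tail (σ d)) (σ-tail d)))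
    where
    same-face : region d ≡ region (σ (σ d))
    same-face = adj≤1 (region (σ d)) (region d) (region (σ (σ d)))
      (triCorner⇒3face t₁) (triCorner⇒3face t₀) (triCorner⇒3face t₂)
      (region-σ≢ d t₀ t₁ , rev d , region-rev d , cong region (rev-invol d))
      (region-σ≢ (σ d) t₁ t₂ ∘ sym , σ d , refl , region-rev (σ d))

  corner : Fin m → ℕ
  corner c = ⟦ triCorner? c ⟧

  corners-window : ∀ d → corner d + corner (σ d) + corner (σ (σ d)) ≤ 2
  corners-window d with triCorner? d | triCorner? (σ d) | triCorner? (σ (σ d))
  ... | yes t₀ | yes t₁ | yes t₂ = ⊥-elim (no-three-consecutive d t₀ t₁ t₂)
  ... | yes _  | yes _  | no _   = ≤-refl
  ... | yes _  | no _   | yes _  = ≤-refl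
  ... | no _   | yes _  | yes _  = ≤-refl
  ... | yes _  | no _   | no _   = s≤s z≤n
  ... | no _   | yes _  | no _   = s≤s z≤n
  ... | no _   | no _   | yes _  = s≤s z≤n
  ... | no _   | no _   | no _   = z≤n

  corners-at : ∀ v → 3 * vertexSum v corner ≤ 2 * deg G v
  corners-at v = begin
    3 * S corner                                           ≡⟨ triple (S corner) ⟩
    S corner + S corner + S corner                         ≡⟨ cong₂ (λ a b → S corner + a + b) shift₁ shift₂ ⟨
    S corner + S (corner ∘ σ) + S (corner ∘ σ ∘ σ)         ≡⟨ cong (_+ S (corner ∘ σ ∘ σ)) (vertexSum-+ v _ _) ⟨
    S (λ d → corner d + corner (σ d)) + S (corner ∘ σ ∘ σ) ≡⟨ vertexSum-+ v (λ d → corner d + corner (σ d)) _ ⟨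
    S (λ d → corner d + corner (σ d) + corner (σ (σ d)))   ≤⟨ vertexSum-mono v (λ d _ → corners-window d) ⟩
    S (λ _ → 2 * 1)                                      ≡⟨ vertexSum-* v 2 (λ _ → 1) ⟩
    2 * S (λ _ → 1)                                      ≡⟨ cong (2 *_) (vertexSum-1 v) ⟩
    2 * deg G v                                          ∎
    where
    open ≤-Reasoning
    S : (Fin m → ℕ) → ℕ
    S = vertexSum v
    shift₁ : S (corner ∘ σ) ≡ S corner
    shift₁ = vertexSum-σ v corner
    shift₂ : S (corner ∘ σ ∘ σ) ≡ S corner
    shift₂ = trans (vertexSum-σ v (corner ∘ σ)) shift₁
    triple : ∀ x → 3 * x ≡ x + x + x
    triple = solve-∀

  transferAt : Fin m → ℕ
  transferAt c = transfer (cls (tail c)) (cls (tail (φ c))) (cls (tail (φ (φ c))))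

  sent : Fin m → ℕ
  sent c = corner c * transferAt c

  sent-triCorner : ∀ {c} → TriCorner c → sent c ≡ transferAt c
  sent-triCorner {c} t = trans (cong (_* transferAt c) (⟦⟧≡1 (triCorner? c) t)) (+-identityʳ _)

  sent≤ : ∀ c K → (TriCorner c → transferAt c ≤ K) → sent c ≤ K * corner c
  sent≤ c K bound with triCorner? c
  ... | yes t = ≤-trans (≤-reflexive (*-identityˡ _)) (≤-trans (bound t) (≤-reflexive (sym (*-identityʳ K))))
  ... | no  _ = z≤n

  sent≤4 : ∀ c → sent c ≤ 4
  sent≤4 c = ≤-trans (sent≤ c 4 (λ _ → transfer≤4 _ _ _)) (*-monoʳ-≤ 4 (⟦⟧≤1 (triCorner? c)))

  transferAt-at : ∀ {v} d → tail d ≡ v →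
    transferAt d ≡ transfer (degClass (deg G v)) (cls (tail (φ d))) (cls (tail (φ (φ d))))
  transferAt-at d refl = refl

  sentAt≤ : ∀ v K → (∀ b c → transfer (degClass (deg G v)) b c ≤ K) → vertexSum v sent ≤ K * vertexSum v corner
  sentAt≤ v K bound = ≤-trans
    (vertexSum-mono v (λ d td≡v → sent≤ d K (λ _ → subst (_≤ K) (sym (transferAt-at d td≡v)) (bound _ _))))
    (≤-reflexive (vertexSum-* v K corner))

  corners≤ : ∀ v {D} → deg G v ≡ D → 3 * vertexSum v corner ≤ 2 * D
  corners≤ v refl = corners-at v

  charge-deg4 : ∀ {v} → deg G v ≡ 4 → vertexSum v sent + 24 ≤ 6 * 4
  charge-deg4 {v} deg≡4 = +-monoˡ-≤ 24
    (sentAt≤ v 0 (λ b c → subst (λ k → transfer (degClass k) b c ≤ 0) (sym deg≡4) z≤n))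

  charge-deg5 : ∀ {v} → deg G v ≡ 5 → vertexSum v sent + 24 ≤ 6 * 5
  charge-deg5 {v} deg≡5 = +-monoˡ-≤ 24 (≤-trans
    (sentAt≤ v 2 (λ b c → subst (λ k → transfer (degClass k) b c ≤ 2) (sym deg≡5) ≤-refl))
    (*-monoʳ-≤ 2 (3m≤3n+2⇒m≤n {vertexSum v corner} 3 (≤-trans (corners≤ v deg≡5) (m≤m+n 10 1)))))

  charge-deg7+ : ∀ {v} k → deg G v ≡ 7 + k → vertexSum v sent + 24 ≤ 6 * (7 + k)
  charge-deg7+ {v} k deg≡ = high-degree-balance k {vertexSum v sent} {vertexSum v corner}
    (sentAt≤ v 4 (transfer≤4 (degClass (deg G v)))) (corners≤ v deg≡)

  module Degree6 {v} (deg≡6 : deg G v ≡ 6) where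

    corners≤4 : vertexSum v corner ≤ 4
    corners≤4 = 3m≤3n+2⇒m≤n 4 (≤-trans (corners≤ v deg≡6) (m≤m+n 12 2))

    transferAt-six : ∀ d → tail d ≡ v → transferAt d ≡ transfer sixPlus (cls (tail (φ d))) (cls (tail (φ (φ d))))
    transferAt-six d td = trans (transferAt-at d td) (cong (λ k → transfer (degClass k) _ _) deg≡6)

    triangle-at : ∀ {d} → tail d ≡ v → Triangular d → Triangle G v (tail (φ d)) (tail (φ (φ d)))
    triangle-at td tri = subst (λ u → Triangle G u _ _) td (triangular⇒Triangle tri)

    without-4 : (∀ d → tail d ≡ v → TriCorner d → transferAt d ≢ 4) → vertexSum v sent ≤ 12
    without-4 ≢4 = begin
      vertexSum v sent                 ≤⟨ vertexSum-mono v (λ d td → sent≤ d 3 (≤3 d td)) ⟩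
      vertexSum v (λ d → 3 * corner d) ≡⟨ vertexSum-* v 3 corner ⟩
      3 * vertexSum v corner           ≤⟨ *-monoʳ-≤ 3 corners≤4 ⟩
      12                               ∎
      where
      open ≤-Reasoning
      ≤3 : ∀ d → tail d ≡ v → TriCorner d → transferAt d ≤ 3
      ≤3 d td t = s≤s⁻¹ (≤∧≢⇒< (transfer≤4 _ _ _) (≢4 d td t))

    -- By ¬H3, x is the only neighbour of degree 4, so only the two corners at the edge vx receive more than 2.
    module With45Triangle {x y} (T : Triangle G x y v) (deg-x : deg G x ≡ 4) (deg-y : deg G y ≡ 5) where

      x~v : Adj G x v
      x~v = proj₂ (proj₂ T)

      e : Fin m
      e = proj₁ (Adj-sym x~v)

      tail-e : tail e ≡ v
      tail-e = proj₁ (proj₂ (Adj-sym x~v))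

      head-e : tail (rev e) ≡ x
      head-e = proj₂ (proj₂ (Adj-sym x~v))

      unique-4-neighbour : ∀ w → Adj G v w → deg G w ≡ 4 → w ≡ x
      unique-4-neighbour w v~w@(d , refl , refl) deg-w with w ≟ x
      ... | yes w≡x = w≡x
      ... | no  w≢x = ⊥-elim (¬h3 (x , y , v , T , deg-x , deg-y , deg≡6 , w , v~w , deg-w , w≢x , w≢y , no-loop d))
        where
        w≢y : w ≢ y
        w≢y refl with () ← trans (sym deg-w) deg-y

      rich-corner : ∀ d → tail d ≡ v → TriCorner d → 3 ≤ transferAt d → d ≡ e ⊎ d ≡ σ e
      rich-corner d td (tri , _) ≥3 with transfer-sixPlus≥3 _ _ (subst (3 ≤_) (transferAt-six d td) ≥3)
      ... | inj₁ four≡ = inj₁ (dart-determined (trans td (sym tail-e))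
              (trans (unique-4-neighbour _ (proj₁ (triangle-at td tri)) (cls≡four⇒deg≡4 four≡)) (sym head-e)))
      ... | inj₂ four≡ = inj₂ (triangular≡σ tri (trans td (sym tail-e))
              (trans (unique-4-neighbour _ (proj₂ (proj₂ (triangle-at td tri))) (cls≡four⇒deg≡4 four≡)) (sym head-e)))

      at-e : Fin m → ℕ
      at-e d = ⟦ d ≟ e ⟧ + ⟦ d ≟ σ e ⟧

      hits-e : ∀ {d} → d ≡ e ⊎ d ≡ σ e → 1 ≤ at-e d
      hits-e {d} (inj₁ d≡e)  = ≤-trans (≤-reflexive (sym (⟦⟧≡1 (d ≟ e) d≡e))) (m≤m+n _ _)
      hits-e {d} (inj₂ d≡σe) = ≤-trans (≤-reflexive (sym (⟦⟧≡1 (d ≟ σ e) d≡σe))) (m≤n+m _ _)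

      sent≤2+e : ∀ d → tail d ≡ v → sent d ≤ 2 * corner d + 2 * at-e d
      sent≤2+e d td with triCorner? d
      ... | no  _ = z≤n
      ... | yes t with transferAt d ≤? 2
      ...   | yes ≤2 = ≤-trans (≤-reflexive (*-identityˡ _)) (≤-trans ≤2 (m≤m+n 2 _))
      ...   | no  ≰2 = ≤-trans (≤-reflexive (*-identityˡ _))
                         (≤-trans (transfer≤4 _ _ _)
                           (+-monoʳ-≤ 2 (*-monoʳ-≤ 2 (hits-e (rich-corner d td t (≰⇒> ≰2))))))

      at-e≤2 : vertexSum v at-e ≤ 2
      at-e≤2 = subst (_≤ 2) (sym (vertexSum-+ v (λ d → ⟦ d ≟ e ⟧) (λ d → ⟦ d ≟ σ e ⟧)))
        (+-mono-≤ (vertexSum-point≤1 v e) (vertexSum-point≤1 v (σ e)))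

      bound : vertexSum v sent ≤ 12
      bound = begin
        S sent                                  ≤⟨ vertexSum-mono v sent≤2+e ⟩
        S (λ d → 2 * corner d + 2 * at-e d)     ≡⟨ vertexSum-+ v (λ d → 2 * corner d) (λ d → 2 * at-e d) ⟩
        S (λ d → 2 * corner d) + S (λ d → 2 * at-e d)
                                                ≡⟨ cong₂ _+_ (vertexSum-* v 2 corner) (vertexSum-* v 2 at-e) ⟩
        2 * S corner + 2 * S at-e               ≤⟨ +-mono-≤ (*-monoʳ-≤ 2 corners≤4) (*-monoʳ-≤ 2 at-e≤2) ⟩
        12                                      ∎
        where
        open ≤-Reasoning
        S : (Fin m → ℕ) → ℕ
        S = vertexSum v

    charge : vertexSum v sent + 24 ≤ 6 * 6
    charge with any? (λ d → (tail d ≟ v) ×-dec triCorner? d ×-dec (transferAt d ≟ℕ 4))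
    ... | no  none = +-monoˡ-≤ 24 (without-4 (λ d td t eq → none (d , td , t , eq)))
    ... | yes (c , tc , (tri , _) , ≡4) with transfer-sixPlus≡4 _ _ (trans (sym (transferAt-six c tc)) ≡4)
    ...   | inj₁ (four≡ , five≡) = +-monoˡ-≤ 24
              (With45Triangle.bound (triangle-rotate (triangle-at tc tri)) (cls≡four⇒deg≡4 four≡) (degClass≡five five≡))
    ...   | inj₂ (five≡ , four≡) = +-monoˡ-≤ 24
              (With45Triangle.bound (triangle-reverse (triangle-at tc tri)) (cls≡four⇒deg≡4 four≡) (degClass≡five five≡))

  vertex-charge : ∀ v → vertexSum v sent + 24 ≤ 6 * deg G v
  vertex-charge v with deg G v in deg≡ | δ≥4 v
  ... | 4 | _ = charge-deg4 deg≡
  ... | 5 | _ = charge-deg5 deg≡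
  ... | 6 | _ = Degree6.charge deg≡
  ... | suc (suc (suc (suc (suc (suc (suc k)))))) | _ = charge-deg7+ k deg≡
  ... | 0 | ()
  ... | 1 | s≤s ()
  ... | 2 | s≤s (s≤s ())
  ... | 3 | s≤s (s≤s (s≤s ()))

  ¬reducible : ∀ {x y z} → Triangle G x y z → ¬ Reducible (cls x) (cls y) (cls z)
  ¬reducible (x~y , _) (inj₁ (x4 , y4)) = ¬h1 (_ , _ , x~y , cls≡four⇒deg≡4 x4 , cls≡four⇒deg≡4 y4)
  ¬reducible T (inj₂ (x4 , y5 , z5)) = ¬h2 (_ , _ , _ , T , cls≡four⇒deg≡4 x4 , degClass≡five y5 , degClass≡five z5)

  triangle-received : ∀ {c} → TriCorner c → 6 ≤ sent c + sent (φ c) + sent (φ (φ c))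
  triangle-received {c} t@(tri , _) = subst (6 ≤_) (sym received)
    (received≥6 X Y Z (¬reducible T) (¬reducible (triangle-rotate T))
      (¬reducible (triangle-rotate (triangle-rotate T))))
    where
    T : Triangle G (tail c) (tail (φ c)) (tail (φ (φ c)))
    T = triangular⇒Triangle tri
    X Y Z : DegClass
    X = cls (tail c)
    Y = cls (tail (φ c))
    Z = cls (tail (φ (φ c)))
    received : sent c + sent (φ c) + sent (φ (φ c)) ≡ transfer X Y Z + transfer Y Z X + transfer Z X Y
    received = cong₂ _+_
      (cong₂ _+_ (sent-triCorner t)
        (trans (sent-triCorner (triCorner-φ t)) (cong (λ w → transfer Y Z (cls (tail w))) tri)))
      (trans (sent-triCorner (triCorner-φ (triCorner-φ t)))
        (cong₂ (λ w w′ → transfer Z (cls (tail w)) (cls (tail w′))) tri (cong φ tri)))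

  -- Charges are split among darts: a dart d gets 6 − sent d on the vertex side and 6 + sent d on the
  -- face side, plus 6 at one dart d∞ of the outer walk of the component.  Thus every vertex and every
  -- facial walk of the component gets at least 24, while the total is 12 per dart plus 6.
  module Counting (inComponent? : ∀ d → Dec (Conn d₀ d))
                  (σ-orbit? : ∀ a b → Dec (SameOrbit σ a b)) (φ-orbit? : ∀ a b → Dec (SameOrbit φ a b))
                  (d∞ : Fin m) (d₀~d∞ : Conn d₀ d∞) (outer-d∞ : outer d∞ ≡ true) where

    isOuter : Fin m → ℕ
    isOuter d = ⟦ d ≟ d∞ ⟧

    vertexShare faceShare : Fin m → ℕ
    vertexShare d = 6 ∸ sent d
    faceShare   d = 6 + sent d + 6 * isOuter d

    sent≤6 : ∀ d → sent d ≤ 6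
    sent≤6 d = ≤-trans (sent≤4 d) (m≤m+n 4 2)

    shares : ∀ d → vertexShare d + faceShare d ≡ 12 + 6 * isOuter d
    shares d = begin
      6 ∸ sent d + (6 + sent d + 6 * isOuter d) ≡⟨ regroup (6 ∸ sent d) (sent d) (6 * isOuter d) ⟩
      (6 ∸ sent d + sent d) + 6 + 6 * isOuter d ≡⟨ cong (λ k → k + 6 + 6 * isOuter d) (m∸n+n≡m (sent≤6 d)) ⟩
      12 + 6 * isOuter d                        ∎
      where
      open ≡-Reasoning
      regroup : ∀ a s o → a + (6 + s + o) ≡ (a + s) + 6 + o
      regroup = solve-∀

    weight : (Fin m → ℕ) → Fin m → ℕ
    weight share d = ⟦ inComponent? d ⟧ * share d

    vertex-class : ∀ r → Conn d₀ r → 24 ≤ ∑[ d < m ] (⟦ σ-orbit? d r ⟧ * weight vertexShare d)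
    vertex-class r d₀~r = begin
      24                                                   ≤⟨ +-cancelˡ-≤ (S sent) 24 (S vertexShare) charge ⟩
      S vertexShare                                        ≤⟨ sum-mono at-v⇒in-class ⟩
      ∑[ d < m ] (⟦ σ-orbit? d r ⟧ * weight vertexShare d) ∎
      where
      open ≤-Reasoning
      v : Fin n
      v = tail r
      S : (Fin m → ℕ) → ℕ
      S = vertexSum v
      split : ∀ d → 6 ≡ sent d + vertexShare d
      split d = sym (m+[n∸m]≡n (sent≤6 d))
      charge : S sent + 24 ≤ S sent + S vertexShare
      charge = begin
        S sent + 24                       ≤⟨ vertex-charge v ⟩
        6 * deg G v                       ≡⟨ cong (6 *_) (vertexSum-1 v) ⟨
        6 * S (λ _ → 1)                   ≡⟨ vertexSum-* v 6 (λ _ → 1) ⟨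
        S (λ _ → 6)                       ≡⟨ sum-cong-≗ (λ d → cong (⟦ tail d ≟ v ⟧ *_) (split d)) ⟩
        S (λ d → sent d + vertexShare d)  ≡⟨ vertexSum-+ v sent vertexShare ⟩
        S sent + S vertexShare            ∎
      at-v⇒in-class : ∀ d → ⟦ tail d ≟ v ⟧ * vertexShare d ≤ ⟦ σ-orbit? d r ⟧ * weight vertexShare d
      at-v⇒in-class d with tail d ≟ v
      ... | no  _    = z≤n
      ... | yes td≡v
        rewrite ⟦⟧≡1 (σ-orbit? d r) (σ-trans d r td≡v)
              | ⟦⟧≡1 (inComponent? d) (d₀~r ◅◅ conn-sameOrbit conn-σ (σ-trans r d (sym td≡v))) =
        ≤-reflexive (sym (*-identityˡ _))

    walk≤class : ∀ r → Conn d₀ r → ∀ k → (∀ p → 0 < p → p < k → iter φ p r ≢ r) →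
      ∑[ j < k ] faceShare (iter φ (toℕ j) r) ≤ ∑[ d < m ] (⟦ φ-orbit? d r ⟧ * weight faceShare d)
    walk≤class r d₀~r k aperiodic = subst (_≤ sum u) (sum-cong-≗ {k} in-class)
      (sum-∘-injective≤ (λ j → iter φ (toℕ j) r) (φ-Orbit.iter-injective-below aperiodic) u)
      where
      u : Fin m → ℕ
      u d = ⟦ φ-orbit? d r ⟧ * weight faceShare d
      in-class : ∀ j → u (iter φ (toℕ j) r) ≡ faceShare (iter φ (toℕ j) r)
      in-class j
        rewrite ⟦⟧≡1 (φ-orbit? (iter φ (toℕ j) r) r) (φ-Orbit.sameOrbit-sym (toℕ j , refl))
              | ⟦⟧≡1 (inComponent? (iter φ (toℕ j) r)) (d₀~r ◅◅ conn-iter conn-φ (toℕ j) r) =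
        trans (+-identityʳ _) (+-identityʳ _)

    triangle-enough : ∀ r → Conn d₀ r → Triangular r →
      6 ≤ sent r + sent (φ r) + sent (φ (φ r)) ⊎ 1 ≤ ∑[ j < 3 ] isOuter (iter φ (toℕ j) r)
    triangle-enough r d₀~r tri = by-outer (outer r) refl
      where
      by-outer : ∀ b → outer r ≡ b →
        6 ≤ sent r + sent (φ r) + sent (φ (φ r)) ⊎ 1 ≤ ∑[ j < 3 ] isOuter (iter φ (toℕ j) r)
      by-outer false inner = inj₁ (triangle-received (tri , inner , sym (depth-conn d₀ r d₀~r)))
      by-outer true  outer-r
        with j , d∞≡ ← φ-Orbit.sameOrbit⇒iter< {3} tri
                         (outer-unique r d∞ (conn-sym d₀~r ◅◅ d₀~d∞) outer-r outer-d∞)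
        = inj₂ (subst (_≤ _) (⟦⟧≡1 (iter φ (toℕ j) r ≟ d∞) (sym d∞≡))
                 (term≤sum (λ j → isOuter (iter φ (toℕ j) r)) j))

    face-class : ∀ r → Conn d₀ r → 24 ≤ ∑[ d < m ] (⟦ φ-orbit? d r ⟧ * weight faceShare d)
    face-class r d₀~r with iter φ 3 r ≟ r
    ... | yes tri = ≤-trans
      (triangle-share≥24 (sent r) (sent (φ r)) (sent (φ (φ r))) (isOuter r) (isOuter (φ r)) (isOuter (φ (φ r)))
        (triangle-enough r d₀~r tri))
      (walk≤class r d₀~r 3 (faceWalk-aperiodic r))
    ... | no ¬tri = ≤-trans (sum-mono {4} {λ _ → 6} share≥6) (walk≤class r d₀~r 4 aperiodic)
      where
      share≥6 : ∀ j → 6 ≤ faceShare (iter φ (toℕ j) r)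
      share≥6 j = ≤-trans (m≤m+n 6 (sent _)) (m≤m+n _ (6 * isOuter (iter φ (toℕ j) r)))
      aperiodic : ∀ p → 0 < p → p < 4 → iter φ p r ≢ r
      aperiodic 1 _ _ = faceWalk-aperiodic r 1 (s≤s z≤n) (s≤s (s≤s z≤n))
      aperiodic 2 _ _ = faceWalk-aperiodic r 2 (s≤s z≤n) ≤-refl
      aperiodic 3 _ _ = ¬tri
      aperiodic (suc (suc (suc (suc _)))) _ (s≤s (s≤s (s≤s (s≤s ()))))

    shares-total : sum (weight vertexShare) + sum (weight faceShare) ≤ 12 * ∑[ d < m ] ⟦ inComponent? d ⟧ + 6
    shares-total = begin
      sum (weight vertexShare) + sum (weight faceShare)      ≡⟨ ∑-distrib-+ (weight vertexShare) (weight faceShare) ⟨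
      ∑[ d < m ] (weight vertexShare d + weight faceShare d) ≡⟨ sum-cong-≗ both-shares ⟩
      ∑[ d < m ] (c d * (12 + 6 * isOuter d))                ≤⟨ sum-mono pointwise ⟩
      ∑[ d < m ] (12 * c d + 6 * isOuter d)                  ≡⟨ ∑-distrib-+ (λ d → 12 * c d) (λ d → 6 * isOuter d) ⟩
      ∑[ d < m ] (12 * c d) + ∑[ d < m ] (6 * isOuter d)
        ≡⟨ cong₂ _+_ (sym (*-distribˡ-sum 12 c)) (trans (sym (*-distribˡ-sum 6 isOuter)) (cong (6 *_) one-outer)) ⟩
      12 * ∑[ d < m ] c d + 6                                ∎
      where
      open ≤-Reasoning
      c : Fin m → ℕ
      c d = ⟦ inComponent? d ⟧
      both-shares : ∀ d → weight vertexShare d + weight faceShare d ≡ c d * (12 + 6 * isOuter d)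
      both-shares d = trans (sym (*-distribˡ-+ (c d) (vertexShare d) (faceShare d))) (cong (c d *_) (shares d))
      pointwise : ∀ d → c d * (12 + 6 * isOuter d) ≤ 12 * c d + 6 * isOuter d
      pointwise d with inComponent? d
      ... | yes _ = ≤-reflexive (+-identityʳ _)
      ... | no  _ = z≤n
      one-outer : sum isOuter ≡ 1
      one-outer = trans (sum-cong-≗ (λ d → sym (*-identityʳ (isOuter d)))) (sum-point d∞ (λ _ → 1))

    impossible : ⊥
    impossible = count
      (numClasses-exists σ-orbit? σ-Orbit.sameOrbit-sym inComponent? σ-Orbit.sameOrbit-refl)
      (numClasses-exists φ-orbit? φ-Orbit.sameOrbit-sym inComponent? φ-Orbit.sameOrbit-refl)
      (numClasses-exists _≟_ sym inComponent? (λ _ → refl))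
      where
      count : ∃ (NumClasses (SameOrbit σ) (Conn d₀)) → ∃ (NumClasses (SameOrbit φ) (Conn d₀)) →
              ∃ (NumClasses _≡_ (Conn d₀)) → ⊥
      count (V , vertices@(repV , inV , distinctV , _)) (F , faces@(repF , inF , distinctF , _)) (D , darts) =
        euler-overcharged V F D
          (classes-weight≥ σ-orbit? σ-Orbit.sameOrbit-sym σ-Orbit.sameOrbit-trans
             repV distinctV (weight vertexShare) (λ i → vertex-class (repV i) (inV i)))
          (classes-weight≥ φ-orbit? φ-Orbit.sameOrbit-sym φ-Orbit.sameOrbit-trans
             repF distinctF (weight faceShare) (λ i → face-class (repF i) (inF i)))
          shares-total
          (numClasses-≡-count≤ inComponent? darts)
          (euler d₀ V F D vertices faces darts)

module Configurations {n} (G : PlaneGraph n) where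
  open PlaneGraph G

  Adj? : ∀ u v → Dec (Adj G u v)
  Adj? u v = any? (λ d → (tail d ≟ u) ×-dec (tail (rev d) ≟ v))

  Triangle? : ∀ x y z → Dec (Triangle G x y z)
  Triangle? x y z = Adj? x y ×-dec Adj? y z ×-dec Adj? x z

  H1? : Dec (H1 G)
  H1? = any? λ u → any? λ v → Adj? u v ×-dec (deg G u ≟ℕ 4) ×-dec (deg G v ≟ℕ 4)

  H2? : Dec (H2 G)
  H2? = any? λ x → any? λ y → any? λ z →
    Triangle? x y z ×-dec (deg G x ≟ℕ 4) ×-dec (deg G y ≟ℕ 5) ×-dec (deg G z ≟ℕ 5)

  H3? : Dec (H3 G)
  H3? = any? λ x → any? λ y → any? λ z →
    Triangle? x y z ×-dec (deg G x ≟ℕ 4) ×-dec (deg G y ≟ℕ 5) ×-dec (deg G z ≟ℕ 6) ×-dec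
    any? (λ w → Adj? z w ×-dec (deg G w ≟ℕ 4) ×-dec ¬? (w ≟ x) ×-dec ¬? (w ≟ y) ×-dec ¬? (w ≟ z))

dart-at : ∀ {m n} {tail : Fin m → Fin n} {v} → 4 ≤ countEq tail v → Fin m
dart-at {zero}  ()
dart-at {suc _} _ = zero

-- Decidability of the connectivity and orbit relations is only available classically; since the goal
-- is ⊥ it may be assumed.
unavoidable : ∀ {n} → 1 ≤ n → (G : PlaneGraph n) →
  Every3FaceAdjAtMostOne3Face G → MinDegAtLeast G 4 → ¬ H1 G → ¬ H2 G → ¬ H3 G → ⊥
unavoidable 1≤n G adj≤1 δ≥4 ¬h1 ¬h2 ¬h3 =
  ¬¬-decidable (Conn d₀) λ inComponent? →
  ¬¬-decidable₂ (SameOrbit σ) λ σ-orbit? →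
  ¬¬-decidable₂ (SameOrbit φ) λ φ-orbit? →
  let d∞ , d₀~d∞ , outer-d∞ = outer-exists d₀
  in  Discharging.Counting.impossible G adj≤1 δ≥4 ¬h1 ¬h2 ¬h3 d₀ deepest
        inComponent? σ-orbit? φ-orbit? d∞ d₀~d∞ outer-d∞
  where
  open PlaneGraph G
  some-dart : Fin m
  some-dart = dart-at (δ≥4 (fromℕ< 1≤n))
  d₀ : Fin m
  d₀ = argmax depth some-dart (allFin m)
  deepest : ∀ d → depth d ≤ depth d₀
  deepest d = lookup (f[xs]≤f[argmax] some-dart (allFin m)) (∈-allFin d)

theorem7 : ∀ {n} → 1 ≤ n → (G : PlaneGraph n) →
    Every3FaceAdjAtMostOne3Face G → MinDegAtLeast G 4 →
    H1 G ⊎ H2 G ⊎ H3 G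
theorem7 1≤n G adj≤1 δ≥4 with Configurations.H1? G | Configurations.H2? G | Configurations.H3? G
... | yes h1 | _      | _      = inj₁ h1
... | no _   | yes h2 | _      = inj₂ (inj₁ h2)
... | no _   | no _   | yes h3 = inj₂ (inj₂ h3)
... | no ¬h1 | no ¬h2 | no ¬h3 = ⊥-elim (unavoidable 1≤n G adj≤1 δ≥4 ¬h1 ¬h2 ¬h3)
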